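{- Let $\Sigma=(V,E,\{P_e\}_{e\in E})$ be a signature, let $g$ be a gateway between sets of edges $A,B\subseteq E$, and let $\phi\in\Phi(\Sigma,\{g\})$, $\psi\in\Phi(\Sigma,A)$, $\chi\in\Phi(\Sigma,B)$. Then $\vdash\Box_g(\phi\vee\psi\vee\chi)\to(\phi\vee\Box_g\psi\vee\Box_g\chi)$.
   Context: A signature is a triple $\Sigma=(V,E,\{P_e\}_{e\in E})$ where $(V,E)$ is a connected undirected graph (loops and multiple edges allowed) and $\{P_e\}$ are pairwise disjoint sets of propositional letters. $Inc(v)$ is the set of edges incident to $v$. $\Phi(\Sigma)$ is the least set of formulas containing $\bot$ and all letters in $\bigcup_e P_e$, closed under $\to$ and under $\Box_e$ for $e\in E$; $\neg\phi$ abbreviates $\phi\to\bot$ and $\phi\vee\psi$ abbreviates $\neg\phi\to\psi$. For $T\subseteq E$, $\Phi(\Sigma,T)$ is the least set containing $\bot$ and $P_t$ for $t\in T$, closed under $\to$, and containing $\Box_t\phi$ for every $t\in T$ and every $\phi\in\Phi(\Sigma)$. A path is a sequence $e_0,v_1,e_1,\dots,v_k,e_k$ ($k\ge0$) of pairwise distinct edges and pairwise distinct vertices with $e_i,e_{i+1}\in Inc(v_{i+1})$. Edge $g$ is a gateway between sets of edges $A$ and $B$ if every path starting with an edge in $A$ and ending with an edge in $B$ contains $g$. $\vdash$ denotes provability in the system with axioms: all propositional tautologies of $\Phi(\Sigma)$; $\Box_e\phi\to\phi$; $\Box_e\phi\to\Box_e\Box_e\phi$; $\neg\Box_e\phi\to\Box_e\neg\Box_e\phi$;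 $\Box_e(\phi\to\psi)\to(\Box_e\phi\to\Box_e\psi)$; and Gateway $\Box_e(\phi\to\psi)\to(\phi\to\Box_g\psi)$ whenever $g$ is a gateway between $A,B\subseteq E$, $e\in A$, $\phi\in\Phi(\Sigma,A)$, $\psi\in\Phi(\Sigma,B)$; and rules Modus Ponens and Necessitation (from $\phi$ infer $\Box_e\phi$). -}

module Defs where

open import Data.Bool using (Bool; true; false; _∧_; _∨_; not)
open import Data.Product using (_×_; _,_; proj₁; proj₂)
open import Data.Sum using (_⊎_)
open import Data.List using (List; []; _∷_; [_])
open import Data.List.Membership.Propositional using (_∈_)
open import Data.List.Relation.Unary.Unique.Propositional using (Unique)
open import Relation.Binary.PropositionalEquality using (_≡_)

-- Graph data: an endpoint map on edges (loops and multiple edges allowed).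
module Graph {V E : Set} (ends : E → V × V) where
  Inc : V → E → Set
  Inc v e = (proj₁ (ends e) ≡ v) ⊎ (proj₂ (ends e) ≡ v)

  Adj : V → V → Set
  Adj u w = Data.Product.Σ E (λ e → Inc u e × Inc w e)

  data Reach : V → V → Set where
    here  : ∀ {u} → Reach u u
    there : ∀ {u w x} → Adj u w → Reach w x → Reach u x

  Connected : Set
  Connected = ∀ u w → Reach u w

-- A signature: a connected graph together with propositional letters each
-- assigned to exactly one edge (letter p belongs to P_(edgeOf p); this makes
-- the P_e pairwise disjoint, and the letters of Φ(Σ) are exactly ⋃_e P_e).
record Signature : Set₁ where
  field
    V         : Set
    E         : Set
    ends      : E → V × V
    Letter    : Set
    edgeOf    : Letter → E
    connected : Graph.Connected ends
  open Graph ends public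

module Syntax (Σ : Signature) where
  open Signature Σ

  infixr 5 _⇒_
  data Fm : Set where
    ⊥'  : Fm
    var : Letter → Fm
    _⇒_ : Fm → Fm → Fm
    □   : E → Fm → Fm

  ¬' : Fm → Fm
  ¬' φ = φ ⇒ ⊥'

  infixr 4 _∨'_
  _∨'_ : Fm → Fm → Fm
  φ ∨' ψ = ¬' φ ⇒ ψ

  -- Φ(Σ,T) for T ⊆ E given as a predicate
  data InΦ (T : E → Set) : Fm → Set where
    bot : InΦ T ⊥'
    let' : ∀ {p} → T (edgeOf p) → InΦ T (var p)
    imp : ∀ {φ ψ} → InΦ T φ → InΦ T ψ → InΦ T (φ ⇒ ψ)
    box : ∀ {t} φ → T t → InΦ T (□ t φ)

  -- Walks e0,v1,e1,...,vk,ek from edge e to edge f; es = e0..ek, vs = v1..vk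
  data Walk : E → E → List E → List V → Set where
    single : ∀ e → Walk e e [ e ] []
    step   : ∀ {e v e' f es vs} → Inc v e → Inc v e' →
             Walk e' f es vs → Walk e f (e ∷ es) (v ∷ vs)

  record Path (e f : E) : Set where
    field
      edges    : List E
      vertices : List V
      walk     : Walk e f edges vertices
      uniqE    : Unique edges
      uniqV    : Unique vertices

  Gateway : E → (E → Set) → (E → Set) → Set
  Gateway g A B = ∀ {e f} → A e → B f → (p : Path e f) → g ∈ Path.edges p

  -- classical propositional evaluation, letters and boxed formulas as atoms
  eval : (Letter → Bool) → (E → Fm → Bool) → Fm → Bool
  eval ρ β ⊥' = false
  eval ρ β (var p) = ρ p
  eval ρ β (φ ⇒ ψ) = not (eval ρ β φ) ∨ eval ρ β ψ
  eval ρ β (□ e φ) = β e φ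

  Tautology : Fm → Set
  Tautology φ = ∀ ρ β → eval ρ β φ ≡ true

  infix 2 ⊢_
  data ⊢_ : Fm → Set₁ where
    taut : ∀ {φ} → Tautology φ → ⊢ φ
    axT  : ∀ e φ → ⊢ (□ e φ ⇒ φ)
    ax4  : ∀ e φ → ⊢ (□ e φ ⇒ □ e (□ e φ))
    ax5  : ∀ e φ → ⊢ (¬' (□ e φ) ⇒ □ e (¬' (□ e φ)))
    axK  : ∀ e φ ψ → ⊢ (□ e (φ ⇒ ψ) ⇒ (□ e φ ⇒ □ e ψ))
    gate : ∀ (g : E) (A B : E → Set) (e : E) (φ ψ : Fm) →
           Gateway g A B → A e → InΦ A φ → InΦ B ψ →
           ⊢ (□ e (φ ⇒ ψ) ⇒ (φ ⇒ □ g ψ))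
    mp   : ∀ {φ ψ} → ⊢ (φ ⇒ ψ) → ⊢ φ → ⊢ ψ
    nec  : ∀ e {φ} → ⊢ φ → ⊢ □ e φ

module Submission where

-- Write the goal as  □g(¬φ → ¬ψ → χ) → ¬φ → ¬□gψ → □gχ.
--   (1) Since ¬φ ∈ Φ(Σ,{g}), the Gateway axiom for the trivial gateway g
--       between {g} and {g} makes ¬φ persistent: ¬φ → □g¬φ.  With K the
--       hypothesis and ¬φ yield □g(¬ψ → χ).
--   (2) g is also a gateway between A ∪ {g} and B, so the Gateway axiom with
--       e = g gives □g(¬ψ → χ) → (¬ψ → □gχ); axiom 4 boxes this consequence:
--       □g(¬ψ → χ) → □g(¬ψ → □gχ).
--   (3) In S5, □e(¬ψ → □eχ) → (¬□eψ → □eχ), using axiom 5 for ¬□eχ.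

open import Defs
open import Data.Bool using (Bool; true; false; _∧_; _∨_; not; T)
open import Data.Bool.Properties using (∧-conicalˡ; ∧-conicalʳ; T-≡)
open import Data.Nat using (ℕ; zero; suc)
open import Data.Fin using (Fin)
open import Data.Fin.Patterns using (0F; 1F; 2F; 3F)
open import Data.Vec using (Vec; []; _∷_; lookup; map)
open import Data.Vec.Properties using (lookup-map)
open import Data.Sum using (_⊎_; inj₁; inj₂)
open import Data.List.Relation.Unary.Any using (here)
open import Data.List.Membership.Propositional using (_∈_)
open import Function.Bundles using (Equivalence)
open import Relation.Binary.PropositionalEquality using (_≡_; refl; sym; trans; cong₂)

infixr 5 _⇛_
data Schema (n : ℕ) : Set where
  ⊥ₛ  : Schema n
  var : Fin n → Schema n
  _⇛_ : Schema n → Schema n → Schema n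

¬ₛ : ∀ {n} → Schema n → Schema n
¬ₛ S = S ⇛ ⊥ₛ

evalₛ : ∀ {n} → Vec Bool n → Schema n → Bool
evalₛ v ⊥ₛ      = false
evalₛ v (var i) = lookup v i
evalₛ v (S ⇛ R) = not (evalₛ v S) ∨ evalₛ v R

-- A predicate on Boolean vectors holds everywhere iff it holds on each of
-- the 2ⁿ vectors, so validity of a schema is decidable by enumeration.
allVectors : (n : ℕ) → (Vec Bool n → Bool) → Bool
allVectors zero    P = P []
allVectors (suc n) P = allVectors n (λ v → P (true ∷ v)) ∧ allVectors n (λ v → P (false ∷ v))

allVectors-sound : ∀ n P → allVectors n P ≡ true → ∀ v → P v ≡ true
allVectors-sound zero    P ok []          = ok
allVectors-sound (suc n) P ok (true ∷ v)  = allVectors-sound n _ (∧-conicalˡ _ _ ok) v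
allVectors-sound (suc n) P ok (false ∷ v) = allVectors-sound n _ (∧-conicalʳ _ _ ok) v

Valid : ∀ {n} → Schema n → Bool
Valid {n} S = allVectors n (λ v → evalₛ v S)

p : ∀ {n} → Schema (suc n)
p = var 0F
q : ∀ {n} → Schema (suc (suc n))
q = var 1F
r : ∀ {n} → Schema (suc (suc (suc n)))
r = var 2F
s : ∀ {n} → Schema (suc (suc (suc (suc n))))
s = var 3F

module Development (Σ : Signature) where
  open Signature Σ
  open Syntax Σ

  instantiate : ∀ {n} → Vec Fm n → Schema n → Fm
  instantiate σ ⊥ₛ      = ⊥'
  instantiate σ (var i) = lookup σ i
  instantiate σ (S ⇛ R) = instantiate σ S ⇒ instantiate σ R

  eval-instantiate : ∀ {n} ρ β (σ : Vec Fm n) S →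
                     eval ρ β (instantiate σ S) ≡ evalₛ (map (eval ρ β) σ) S
  eval-instantiate ρ β σ ⊥ₛ      = refl
  eval-instantiate ρ β σ (var i) = sym (lookup-map i (eval ρ β) σ)
  eval-instantiate ρ β σ (S ⇛ R) =
    cong₂ (λ a b → not a ∨ b) (eval-instantiate ρ β σ S) (eval-instantiate ρ β σ R)

  -- Every instance of a valid schema is provable.  The validity proof is
  -- found by computation, so it can be left implicit at concrete schemas.
  tautology : ∀ {n} (S : Schema n) {valid : T (Valid S)} (σ : Vec Fm n) →
              ⊢ instantiate σ S
  tautology S {valid} σ = taut λ ρ β →
    trans (eval-instantiate ρ β σ S)
          (allVectors-sound _ _ (Equivalence.to T-≡ valid) (map (eval ρ β) σ))

  syllogism : ∀ {a b c} → ⊢ a ⇒ b → ⊢ b ⇒ c → ⊢ a ⇒ c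
  syllogism {a} {b} {c} ab bc =
    mp (mp (tautology {3} ((p ⇛ q) ⇛ (q ⇛ r) ⇛ (p ⇛ r)) (a ∷ b ∷ c ∷ [])) ab) bc

  syllogism₂ : ∀ {h a b c} → ⊢ h ⇒ a ⇒ b → ⊢ b ⇒ c → ⊢ h ⇒ a ⇒ c
  syllogism₂ {h} {a} {b} {c} hab bc =
    mp (mp (tautology {4} ((p ⇛ q ⇛ r) ⇛ (r ⇛ s) ⇛ (p ⇛ q ⇛ s)) (h ∷ a ∷ b ∷ c ∷ [])) hab) bc

  strengthen₂ : ∀ {h a b c} → ⊢ a ⇒ b → ⊢ h ⇒ b ⇒ c → ⊢ h ⇒ a ⇒ c
  strengthen₂ {h} {a} {b} {c} ab hbc =
    mp (mp (tautology {4} ((q ⇛ r) ⇛ (p ⇛ r ⇛ s) ⇛ (p ⇛ q ⇛ s)) (h ∷ a ∷ b ∷ c ∷ [])) ab) hbc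

  contrapose₂ : ∀ {h a c} → ⊢ h ⇒ ¬' c ⇒ a → ⊢ h ⇒ ¬' a ⇒ c
  contrapose₂ {h} {a} {c} =
    mp (tautology {3} ((p ⇛ ¬ₛ r ⇛ q) ⇛ (p ⇛ ¬ₛ q ⇛ r)) (h ∷ a ∷ c ∷ []))

  box-mono : ∀ e {a b} → ⊢ a ⇒ b → ⊢ □ e a ⇒ □ e b
  box-mono e {a} {b} ab = mp (axK e a b) (nec e ab)

  box-lift : ∀ e {a b} → ⊢ □ e a ⇒ b → ⊢ □ e a ⇒ □ e b
  box-lift e {a} ab = syllogism (ax4 e a) (box-mono e ab)

  box-mp-persistent : ∀ e {a b} → ⊢ a ⇒ □ e a → ⊢ □ e (a ⇒ b) ⇒ a ⇒ □ e b
  box-mp-persistent e {a} {b} persistent = strengthen₂ persistent (axK e a b)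

  box-disjunction-boxed : ∀ e a c → ⊢ □ e (¬' a ⇒ □ e c) ⇒ ¬' (□ e a) ⇒ □ e c
  box-disjunction-boxed e a c = syllogism swapped (contrapose₂ boxed)
    where
      swapped : ⊢ □ e (¬' a ⇒ □ e c) ⇒ □ e (¬' (□ e c) ⇒ a)
      swapped = box-mono e (tautology {2} ((¬ₛ p ⇛ q) ⇛ (¬ₛ q ⇛ p)) (a ∷ □ e c ∷ []))
      boxed : ⊢ □ e (¬' (□ e c) ⇒ a) ⇒ ¬' (□ e c) ⇒ □ e a
      boxed = box-mp-persistent e (ax5 e c)

  -- Gateways.  Every path starting with g contains g, so g is a gateway
  -- from {g} to anything, and adding g to the source set keeps a gateway.
  first-edge-on-path : ∀ {e f es vs} → Walk e f es vs → e ∈ es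
  first-edge-on-path (single e)   = here refl
  first-edge-on-path (step _ _ _) = here refl

  ｛_｝ : E → (E → Set)
  ｛ g ｝ e = e ≡ g

  _∪｛_｝ : (E → Set) → E → (E → Set)
  (A ∪｛ g ｝) e = A e ⊎ e ≡ g

  gateway-from-itself : ∀ g B → Gateway g ｛ g ｝ B
  gateway-from-itself g B refl _ π = first-edge-on-path (Path.walk π)

  gateway-add-source : ∀ {g A B} → Gateway g A B → Gateway g (A ∪｛ g ｝) B
  gateway-add-source gw (inj₁ a) b π = gw a b π
  gateway-add-source {g} {B = B} gw (inj₂ refl) b π = gateway-from-itself g B refl b π

  InΦ-monotone : ∀ {T T′ : E → Set} → (∀ {e} → T e → T′ e) → ∀ {φ} → InΦ T φ → InΦ T′ φ
  InΦ-monotone f bot       = bot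
  InΦ-monotone f (let' x)  = let' (f x)
  InΦ-monotone f (imp a b) = imp (InΦ-monotone f a) (InΦ-monotone f b)
  InΦ-monotone f (box φ x) = box φ (f x)

  persistent : ∀ g {φ} → InΦ ｛ g ｝ φ → ⊢ φ ⇒ □ g φ
  persistent g {φ} inφ =
    mp (gate g ｛ g ｝ ｛ g ｝ g φ φ (gateway-from-itself g ｛ g ｝) refl inφ inφ)
       (nec g (tautology {1} (p ⇛ p) (φ ∷ [])))

  box-through-gateway : ∀ {g A B ψ χ} → Gateway g A B → InΦ A ψ → InΦ B χ →
                        ⊢ □ g (ψ ⇒ χ) ⇒ □ g (ψ ⇒ □ g χ)
  box-through-gateway {g} {A} {B} {ψ} {χ} gw inψ inχ =
    box-lift g (gate g (A ∪｛ g ｝) B g ψ χ (gateway-add-source gw) (inj₂ refl)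
                     (InΦ-monotone inj₁ inψ) inχ)

lemma2 : (Σ : Signature) → let open Signature Σ in let open Syntax Σ in
    (g : E) (A B : E → Set) → Gateway g A B →
    (φ ψ χ : Fm) → InΦ (λ e → e ≡ g) φ → InΦ A ψ → InΦ B χ →
    ⊢ (□ g (φ ∨' ψ ∨' χ) ⇒ (φ ∨' □ g ψ ∨' □ g χ))
lemma2 Σ g A B gw φ ψ χ inφ inψ inχ =
  syllogism₂ (syllogism₂ from-¬φ through-gateway) s5-disjunction
  where
    open Syntax Σ
    open Development Σ
    from-¬φ : ⊢ □ g (¬' φ ⇒ ¬' ψ ⇒ χ) ⇒ ¬' φ ⇒ □ g (¬' ψ ⇒ χ)
    from-¬φ = box-mp-persistent g (persistent g (imp inφ bot))
    through-gateway : ⊢ □ g (¬' ψ ⇒ χ) ⇒ □ g (¬' ψ ⇒ □ g χ)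
    through-gateway = box-through-gateway gw (imp inψ bot) inχ
    s5-disjunction : ⊢ □ g (¬' ψ ⇒ □ g χ) ⇒ ¬' (□ g ψ) ⇒ □ g χ
    s5-disjunction = box-disjunction-boxed g ψ χ
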